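{- Let $m,n$ be positive integers and $a,b,c,d,s,t\in\mathbb{N}$. Let $\boldsymbol{U}=\{(u_{i,j},v_{i,j}): i,j\in\mathbb{N}\}$ with $u_{i,j}=ai+bj+s$ and $v_{i,j}=ci+dj+t$. Then $$\big|\mathcal{IPF}^{(2)}_{m,n}(\boldsymbol{U})\big|=\frac{1}{m!\,n!}\,(st+bnt+scm)\,(s+am+bn+1)^{(m-1)}\,(t+cm+dn+1)^{(n-1)}.$$
   Context: The upper factorial is $r^{(0)}=1$, $r^{(k)}=r(r+1)\cdots(r+k-1)$. For a set $\boldsymbol{U}=\{(u_{i,j},v_{i,j})\}\subset\mathbb{N}^2$ with $u_{i,j}\le u_{i',j'}$, $v_{i,j}\le v_{i',j'}$ whenever $i\le i'$, $j\le j'$: given a lattice path $P=e_1\cdots e_{m+n}$ from $(0,0)$ to $(m,n)$ with steps $E=(1,0)$ and $N=(0,1)$, a pair of sequences $\boldsymbol{a}=(a_0,\dots,a_{m-1})$, $\boldsymbol{b}=(b_0,\dots,b_{n-1})$ is bounded by $P$ with respect to $\boldsymbol{U}$ if for every $r$: when $e_r$ is an $E$-step from $(i,j)$ to $(i+1,j)$ then $a_i<u_{i,j}$, and when $e_r$ is an $N$-step from $(i,j)$ to $(i,j+1)$ then $b_j<v_{i,j}$. $\mathcal{IPF}^{(2)}_{m,n}(\boldsymbol{U})$ (2-dimensional increasing $\boldsymbol{U}$-parking functions) is the set of pairs $(\boldsymbol{a},\boldsymbol{b})$ of non-decreasing sequences of non-negative integers, of lengths $m$ and $n$, that are bounded by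 at least one lattice path from $(0,0)$ to $(m,n)$ with respect to $\boldsymbol{U}$. -}

module Defs where

open import Data.Nat using (ℕ; zero; suc; _+_; _*_; _<_; _≤_)
open import Data.List using (List; []; _∷_; length)
open import Data.List.Relation.Unary.Linked using (Linked)
open import Data.List.Relation.Unary.Unique.Propositional using (Unique)
open import Data.List.Membership.Propositional using (_∈_)
open import Data.Product using (_×_; Σ; ∃; _,_)
open import Data.Unit using (⊤)
open import Data.Empty using (⊥)
open import Function.Bundles using (_⇔_)
open import Relation.Binary.PropositionalEquality using (_≡_)

-- upper (rising) factorial r^(k) = r (r+1) ... (r+k-1)
rising : ℕ → ℕ → ℕ
rising r zero    = 1
rising r (suc k) = r * rising (suc r) k

-- lattice steps E = (1,0), N = (0,1)
data Step : Set where
  E N : Step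

-- Bounded u v i j P as bs : the path P, started at (i,j), bounds the
-- remaining sequences: the k-th E-step of P (from (i',j')) is paired with
-- the k-th remaining entry x of as and requires x < u i' j'; similarly for
-- N-steps, bs and v.  At the start (i,j) = (0,0) and the full sequences
-- a = (a_0..a_{m-1}), b = (b_0..b_{n-1}), this says exactly that the E-step
-- from (i',j') requires a_{i'} < u_{i',j'} and the N-step from (i',j')
-- requires b_{j'} < v_{i',j'}; and P is forced to end at (m,n) where
-- m = length as, n = length bs.
Bounded : (ℕ → ℕ → ℕ) → (ℕ → ℕ → ℕ) → ℕ → ℕ → List Step → List ℕ → List ℕ → Set
Bounded u v i j []      []       []       = ⊤
Bounded u v i j (E ∷ P) (x ∷ as) bs       = x < u i j × Bounded u v (suc i) j P as bs
Bounded u v i j (N ∷ P) as       (y ∷ bs) = y < v i j × Bounded u v i (suc j) P as bs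
Bounded u v i j _       _        _        = ⊥

NonDecreasing : List ℕ → Set
NonDecreasing = Linked _≤_

IPF2 : (u v : ℕ → ℕ → ℕ) (m n : ℕ) → List ℕ × List ℕ → Set
IPF2 u v m n (as , bs) =
  length as ≡ m × length bs ≡ n × NonDecreasing as × NonDecreasing bs ×
  ∃ λ (P : List Step) → Bounded u v 0 0 P as bs

HasCard : {A : Set} → (A → Set) → ℕ → Set
HasCard {A} Q k = Σ (List A) λ L → Unique L × (∀ x → (x ∈ L) ⇔ Q x) × length L ≡ k

-- Split the pairs by the first step of a bounding path.  If the first a-entry
-- x satisfies x < u₀₀, the path may be taken to start with E; otherwise every
-- bounding path starts with N, and then all a-entries are ≥ u₀₀.  For affine U
-- the resulting recursion depends only on how many values the next a- and
-- b-entries may take, and the closed form satisfies the same recursion by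
-- telescoping, thanks to difference identities for rising factorials.
module Submission where

open import Data.Empty using (⊥-elim)
open import Data.List using (List; []; _∷_; _++_; [_]; map; length)
open import Data.List.Properties using (length-++; length-map)
open import Data.List.Membership.Propositional using (_∈_)
open import Data.List.Membership.Propositional.Properties
  using (∈-++⁺ˡ; ∈-++⁺ʳ; ∈-++⁻; ∈-map⁺; ∈-map⁻)
open import Data.List.Relation.Unary.Any using (here)
open import Data.List.Relation.Unary.Linked using (Linked; head; tail)
open import Data.List.Relation.Unary.Unique.Propositional using (Unique)
import Data.List.Relation.Unary.Unique.Propositional.Properties as Unique
open import Data.Nat using (ℕ; zero; suc; _+_; _*_; _∸_; _≤_; _<_; _⊔_; _!; z≤n; s≤s; _<?_)
open import Data.Nat.Properties
open import Data.Nat.Tactic.RingSolver using (solve; solve-∀)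
open import Data.Product using (Σ; ∃; ∃₂; _×_; _,_; proj₁; proj₂; map₁)
open import Data.Sum using (inj₁; inj₂)
open import Data.Unit using (tt)
open import Function.Bundles using (_⇔_; mk⇔)
open import Relation.Binary.PropositionalEquality using (_≡_; refl; sym; trans; cong; cong₂; subst; module ≡-Reasoning)
open import Relation.Nullary using (¬_; yes; no)

open import Defs

-- ∑ p f = f 1 + ⋯ + f p
∑ : ℕ → (ℕ → ℕ) → ℕ
∑ zero    f = 0
∑ (suc p) f = f (suc p) + ∑ p f

∑-scale : ∀ k {f g} p → (∀ e → k * f e ≡ g e) → k * ∑ p f ≡ ∑ p g
∑-scale k zero    _     = *-zeroʳ k
∑-scale k {f} (suc p) k*f≗g =
  trans (*-distribˡ-+ k (f (suc p)) (∑ p f)) (cong₂ _+_ (k*f≗g (suc p)) (∑-scale k p k*f≗g))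

∑-telescope : ∀ (G h : ℕ → ℕ) p → (∀ e → G (suc e) ≡ G e + h (suc e)) → G 0 + ∑ p h ≡ G p
∑-telescope G h zero    _    = +-identityʳ (G 0)
∑-telescope G h (suc p) step = begin
  G 0 + (h (suc p) + ∑ p h) ≡⟨ cong (G 0 +_) (+-comm (h (suc p)) (∑ p h)) ⟩
  G 0 + (∑ p h + h (suc p)) ≡⟨ +-assoc (G 0) (∑ p h) (h (suc p)) ⟨
  G 0 + ∑ p h + h (suc p)   ≡⟨ cong (_+ h (suc p)) (∑-telescope G h p step) ⟩
  G p + h (suc p)           ≡⟨ step p ⟨
  G (suc p)                 ∎
  where open ≡-Reasoning

rising-sucʳ : ∀ x k → rising x (suc k) ≡ rising x k * (x + k)
rising-sucʳ x zero    = base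
  where
  base : x * 1 ≡ 1 * (x + 0)
  base = solve (x ∷ [])
rising-sucʳ x (suc k) = begin
  x * rising (suc x) (suc k)           ≡⟨ cong (x *_) (rising-sucʳ (suc x) k) ⟩
  x * (rising (suc x) k * (suc x + k)) ≡⟨ regroup (rising (suc x) k) ⟩
  x * rising (suc x) k * (x + suc k)   ∎
  where
  open ≡-Reasoning
  regroup : ∀ r → x * (r * (suc x + k)) ≡ x * r * (x + suc k)
  regroup r = solve (r ∷ x ∷ k ∷ [])

factorial-stepˡ : ∀ m k {x y} → m ! * k * x ≡ y → suc m ! * k * x ≡ suc m * y
factorial-stepˡ m k {x} eq = trans (regroup (suc m) (m !) k x) (cong (suc m *_) eq)
  where
  regroup : ∀ l f k x → l * f * k * x ≡ l * (f * k * x)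
  regroup = solve-∀

factorial-stepʳ : ∀ k n {x y} → k * n ! * x ≡ y → k * suc n ! * x ≡ suc n * y
factorial-stepʳ k n {x} eq = trans (regroup (suc n) (n !) k x) (cong (suc n *_) eq)
  where
  regroup : ∀ l f k x → k * (l * f) * x ≡ l * (k * f * x)
  regroup = solve-∀

-- The one-dimensional case: increasing parking functions for u_i = a i + p.
closedForm₁ : (a m p : ℕ) → ℕ
closedForm₁ a zero    p = 1
closedForm₁ a (suc m) p = p * rising (p + a * suc m + 1) m

closedForm₁-step : ∀ a m p →
  closedForm₁ a (suc m) (suc p) ≡ closedForm₁ a (suc m) p + suc m * closedForm₁ a m (suc p + a)
closedForm₁-step a zero    p = base
  where
  base : suc p * 1 ≡ p * 1 + 1 * 1
  base = solve (p ∷ [])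
closedForm₁-step a (suc m) p = begin
  suc p * rising (suc w) (suc m)                ≡⟨ cong (suc p *_) (rising-sucʳ (suc w) m) ⟩
  suc p * (ρ * (suc w + m))                     ≡⟨ identity ρ ⟩
  p * (w * ρ) + suc (suc m) * ((suc p + a) * ρ)
    ≡⟨ cong (λ x → p * (w * ρ) + suc (suc m) * ((suc p + a) * rising x m)) shift ⟩
  p * (w * ρ) + suc (suc m) * ((suc p + a) * rising (suc p + a + a * suc m + 1) m) ∎
  where
  open ≡-Reasoning
  w ρ : ℕ
  w = p + a * suc (suc m) + 1
  ρ = rising (suc w) m
  -- The solver does not unfold local definitions, hence the let.
  identity : ∀ ρ → let w = p + a * suc (suc m) + 1 in
    suc p * (ρ * (suc w + m)) ≡ p * (w * ρ) + suc (suc m) * ((suc p + a) * ρ)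
  identity ρ = solve (ρ ∷ p ∷ a ∷ m ∷ [])
  shift : suc (p + a * suc (suc m) + 1) ≡ suc p + a + a * suc m + 1
  shift = solve (p ∷ a ∷ m ∷ [])

module Counting (a b c d : ℕ) where

  -- count m n p q: the number of pairs of lengths m, n when the first a-entry
  -- may take p values and the first b-entry q, i.e. p = u_{i,j} − α and
  -- q = v_{i,j} − β.  Taking the e-th largest value for the a-entry leaves
  -- e + a values for the next one; after an N-step the a-entries must be
  -- ≥ u_{i,j}, which leaves exactly b values.
  count : (m n p q : ℕ) → ℕ
  count zero    zero    p q = 1
  count (suc m) zero    p q = ∑ p λ e → count m zero (e + a) (q + c)
  count zero    (suc n) p q = ∑ q λ e → count zero n b (e + d)
  count (suc m) (suc n) p q =
    (∑ p λ e → count m (suc n) (e + a) (q + c)) + (∑ q λ e → count (suc m) n b (e + d))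

  closedForm : (m n p q : ℕ) → ℕ
  closedForm zero    n       p q = closedForm₁ d n q
  closedForm (suc m) zero    p q = closedForm₁ a (suc m) p
  closedForm (suc m) (suc n) p q =
    (p * q + b * suc n * q + p * c * suc m)
    * rising (p + a * suc m + b * suc n + 1) m
    * rising (q + c * suc m + d * suc n + 1) n

  closedForm-eastStep : ∀ m n p q →
    closedForm (suc m) n (suc p) q ≡ closedForm (suc m) n p q + suc m * closedForm m n (suc p + a) (q + c)
  closedForm-eastStep zero    zero    p q = closedForm₁-step a zero p
  closedForm-eastStep (suc m) zero    p q = closedForm₁-step a (suc m) p
  closedForm-eastStep zero    (suc n) p q = begin
    L₁ * 1 * σ                     ≡⟨ identity σ ⟩
    L₀ * 1 * σ + 1 * ((q + c) * σ) ≡⟨ cong (λ x → L₀ * 1 * σ + 1 * ((q + c) * rising x n)) shift ⟩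
    L₀ * 1 * σ + 1 * ((q + c) * rising (q + c + d * suc n + 1) n) ∎
    where
    open ≡-Reasoning
    L₁ L₀ σ : ℕ
    L₁ = suc p * q + b * suc n * q + suc p * c * 1
    L₀ = p * q + b * suc n * q + p * c * 1
    σ = rising (q + c * 1 + d * suc n + 1) n
    identity : ∀ σ → (suc p * q + b * suc n * q + suc p * c * 1) * 1 * σ
                     ≡ (p * q + b * suc n * q + p * c * 1) * 1 * σ + 1 * ((q + c) * σ)
    identity σ = solve (σ ∷ p ∷ q ∷ b ∷ c ∷ n ∷ [])
    shift : q + c * 1 + d * suc n + 1 ≡ q + c + d * suc n + 1
    shift = solve (q ∷ c ∷ d ∷ n ∷ [])
  closedForm-eastStep (suc m) (suc n) p q = begin
    L₁ * rising (suc w) (suc m) * σ               ≡⟨ cong (λ x → L₁ * x * σ) (rising-sucʳ (suc w) m) ⟩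
    L₁ * (ρ * (suc w + m)) * σ                    ≡⟨ identity ρ σ ⟩
    L₀ * (w * ρ) * σ + suc (suc m) * (L′ * ρ * σ)
      ≡⟨ cong₂ (λ x y → L₀ * (w * ρ) * σ + suc (suc m) * (L′ * rising x m * rising y n)) shiftᵤ shiftᵥ ⟩
    L₀ * (w * ρ) * σ + suc (suc m) * (L′ * rising (suc p + a + a * suc m + b * suc n + 1) m
                                         * rising (q + c + c * suc m + d * suc n + 1) n) ∎
    where
    open ≡-Reasoning
    w ρ σ L₁ L₀ L′ : ℕ
    w = p + a * suc (suc m) + b * suc n + 1
    ρ = rising (suc w) m
    σ = rising (q + c * suc (suc m) + d * suc n + 1) n
    L₁ = suc p * q + b * suc n * q + suc p * c * suc (suc m)
    L₀ = p * q + b * suc n * q + p * c * suc (suc m)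
    L′ = (suc p + a) * (q + c) + b * suc n * (q + c) + (suc p + a) * c * suc m
    identity : ∀ ρ σ → let w = p + a * suc (suc m) + b * suc n + 1 in
      (suc p * q + b * suc n * q + suc p * c * suc (suc m)) * (ρ * (suc w + m)) * σ
      ≡ (p * q + b * suc n * q + p * c * suc (suc m)) * (w * ρ) * σ
        + suc (suc m) * (((suc p + a) * (q + c) + b * suc n * (q + c) + (suc p + a) * c * suc m) * ρ * σ)
    identity ρ σ = solve (ρ ∷ σ ∷ p ∷ q ∷ a ∷ b ∷ c ∷ m ∷ n ∷ [])
    shiftᵤ : suc (p + a * suc (suc m) + b * suc n + 1) ≡ suc p + a + a * suc m + b * suc n + 1
    shiftᵤ = solve (p ∷ a ∷ b ∷ m ∷ n ∷ [])
    shiftᵥ : q + c * suc (suc m) + d * suc n + 1 ≡ q + c + c * suc m + d * suc n + 1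
    shiftᵥ = solve (q ∷ c ∷ d ∷ m ∷ n ∷ [])

  closedForm-northStep : ∀ m n q →
    closedForm m (suc n) 0 (suc q) ≡ closedForm m (suc n) 0 q + suc n * closedForm m n b (suc q + d)
  closedForm-northStep zero    n       q = closedForm₁-step d n q
  closedForm-northStep (suc m) zero    q = begin
    L₁ * ρ * 1                ≡⟨ identity ρ ⟩
    L₀ * ρ * 1 + 1 * (b * ρ)  ≡⟨ cong (λ x → L₀ * ρ * 1 + 1 * (b * rising x m)) shift ⟩
    L₀ * ρ * 1 + 1 * (b * rising (b + a * suc m + 1) m) ∎
    where
    open ≡-Reasoning
    L₁ L₀ ρ : ℕ
    L₁ = 0 * suc q + b * 1 * suc q + 0 * c * suc m
    L₀ = 0 * q + b * 1 * q + 0 * c * suc m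
    ρ = rising (0 + a * suc m + b * 1 + 1) m
    identity : ∀ ρ → (0 * suc q + b * 1 * suc q + 0 * c * suc m) * ρ * 1
                     ≡ (0 * q + b * 1 * q + 0 * c * suc m) * ρ * 1 + 1 * (b * ρ)
    identity ρ = solve (ρ ∷ q ∷ b ∷ c ∷ m ∷ [])
    shift : 0 + a * suc m + b * 1 + 1 ≡ b + a * suc m + 1
    shift = solve (a ∷ b ∷ m ∷ [])
  closedForm-northStep (suc m) (suc n) q = begin
    L₁ * ρ * rising (suc y) (suc n)               ≡⟨ cong (L₁ * ρ *_) (rising-sucʳ (suc y) n) ⟩
    L₁ * ρ * (σ * (suc y + n))                    ≡⟨ identity ρ σ ⟩
    L₀ * ρ * (y * σ) + suc (suc n) * (L′ * ρ * σ)
      ≡⟨ cong₂ (λ x z → L₀ * ρ * (y * σ) + suc (suc n) * (L′ * rising x m * rising z n)) shiftᵤ shiftᵥ ⟩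
    L₀ * ρ * (y * σ) + suc (suc n) * (L′ * rising (b + a * suc m + b * suc n + 1) m
                                         * rising (suc q + d + c * suc m + d * suc n + 1) n) ∎
    where
    open ≡-Reasoning
    y ρ σ L₁ L₀ L′ : ℕ
    y = q + c * suc m + d * suc (suc n) + 1
    ρ = rising (0 + a * suc m + b * suc (suc n) + 1) m
    σ = rising (suc y) n
    L₁ = 0 * suc q + b * suc (suc n) * suc q + 0 * c * suc m
    L₀ = 0 * q + b * suc (suc n) * q + 0 * c * suc m
    L′ = b * (suc q + d) + b * suc n * (suc q + d) + b * c * suc m
    identity : ∀ ρ σ → let y = q + c * suc m + d * suc (suc n) + 1 in
      (0 * suc q + b * suc (suc n) * suc q + 0 * c * suc m) * ρ * (σ * (suc y + n))
      ≡ (0 * q + b * suc (suc n) * q + 0 * c * suc m) * ρ * (y * σ)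
        + suc (suc n) * ((b * (suc q + d) + b * suc n * (suc q + d) + b * c * suc m) * ρ * σ)
    identity ρ σ = solve (ρ ∷ σ ∷ q ∷ b ∷ c ∷ d ∷ m ∷ n ∷ [])
    shiftᵤ : 0 + a * suc m + b * suc (suc n) + 1 ≡ b + a * suc m + b * suc n + 1
    shiftᵤ = solve (a ∷ b ∷ m ∷ n ∷ [])
    shiftᵥ : suc (q + c * suc m + d * suc (suc n) + 1) ≡ suc q + d + c * suc m + d * suc n + 1
    shiftᵥ = solve (q ∷ c ∷ d ∷ m ∷ n ∷ [])

  closedForm-origin : ∀ m n → closedForm (suc m) (suc n) 0 0 ≡ 0
  closedForm-origin m n = vanish (rising (0 + a * suc m + b * suc n + 1) m) (rising (0 + c * suc m + d * suc n + 1) n)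
    where
    vanish : ∀ ρ σ → (0 * 0 + b * suc n * 0 + 0 * c * suc m) * ρ * σ ≡ 0
    vanish ρ σ = solve (ρ ∷ σ ∷ b ∷ c ∷ m ∷ n ∷ [])

  count-closedForm : ∀ m n p q → m ! * n ! * count m n p q ≡ closedForm m n p q
  count-closedForm zero    zero    p q = refl
  count-closedForm (suc m) zero    p q = begin
    suc m ! * 1 * ∑ p (λ e → count m zero (e + a) (q + c))
      ≡⟨ ∑-scale (suc m ! * 1) p (λ e → factorial-stepˡ m 1 (count-closedForm m zero (e + a) (q + c))) ⟩
    ∑ p hₑ
      ≡⟨ ∑-telescope (λ e → closedForm (suc m) zero e q) hₑ p (λ e → closedForm-eastStep m zero e q) ⟩
    closedForm (suc m) zero p q ∎
    where
    open ≡-Reasoning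
    hₑ : ℕ → ℕ
    hₑ e = suc m * closedForm m zero (e + a) (q + c)
  count-closedForm zero    (suc n) p q = begin
    1 * suc n ! * ∑ q (λ e → count zero n b (e + d))
      ≡⟨ ∑-scale (1 * suc n !) q (λ e → factorial-stepʳ 1 n (count-closedForm zero n b (e + d))) ⟩
    ∑ q hₙ
      ≡⟨ ∑-telescope (closedForm zero (suc n) 0) hₙ q (closedForm-northStep zero n) ⟩
    closedForm zero (suc n) p q ∎
    where
    open ≡-Reasoning
    hₙ : ℕ → ℕ
    hₙ e = suc n * closedForm zero n b (e + d)
  count-closedForm (suc m) (suc n) p q = begin
    suc m ! * suc n ! * (sₑ + sₙ)                       ≡⟨ *-distribˡ-+ (suc m ! * suc n !) sₑ sₙ ⟩
    suc m ! * suc n ! * sₑ + suc m ! * suc n ! * sₙ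
      ≡⟨ cong₂ _+_ (∑-scale (suc m ! * suc n !) p λ e → factorial-stepˡ m (suc n !) (count-closedForm m (suc n) (e + a) (q + c)))
                   (∑-scale (suc m ! * suc n !) q λ e → factorial-stepʳ (suc m !) n (count-closedForm (suc m) n b (e + d))) ⟩
    ∑ p hₑ + ∑ q hₙ                                      ≡⟨ +-comm (∑ p hₑ) (∑ q hₙ) ⟩
    ∑ q hₙ + ∑ p hₑ                                      ≡⟨ cong (λ x → x + ∑ q hₙ + ∑ p hₑ) (closedForm-origin m n) ⟨
    closedForm (suc m) (suc n) 0 0 + ∑ q hₙ + ∑ p hₑ
      ≡⟨ cong (_+ ∑ p hₑ) (∑-telescope (closedForm (suc m) (suc n) 0) hₙ q (closedForm-northStep (suc m) n)) ⟩
    closedForm (suc m) (suc n) 0 q + ∑ p hₑ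
      ≡⟨ ∑-telescope (λ e → closedForm (suc m) (suc n) e q) hₑ p (λ e → closedForm-eastStep m (suc n) e q) ⟩
    closedForm (suc m) (suc n) p q                      ∎
    where
    open ≡-Reasoning
    sₑ sₙ : ℕ
    sₑ = ∑ p λ e → count m (suc n) (e + a) (q + c)
    sₙ = ∑ q λ e → count (suc m) n b (e + d)
    hₑ hₙ : ℕ → ℕ
    hₑ e = suc m * closedForm m (suc n) (e + a) (q + c)
    hₙ e = suc n * closedForm (suc m) n b (e + d)

-- Opened only here: the ring-solver macros above need an unambiguous _∷_.
open import Data.List.Relation.Unary.Linked using ([]; [-]; _∷_)
open import Data.List.Relation.Unary.Unique.Propositional using ([]; _∷_)
open import Data.List.Relation.Unary.All using ([])

Linked-lowerHead : ∀ {x y zs} → x ≤ y → Linked _≤_ (y ∷ zs) → Linked _≤_ (x ∷ zs)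
Linked-lowerHead x≤y [-]         = [-]
Linked-lowerHead x≤y (y≤z ∷ y∷zs) = ≤-trans x≤y y≤z ∷ y∷zs

Linked-0∷ : ∀ {zs} → Linked _≤_ zs → Linked _≤_ (0 ∷ zs)
Linked-0∷ []          = [-]
Linked-0∷ [-]         = z≤n ∷ [-]
Linked-0∷ (z≤z′ ∷ zs) = z≤n ∷ z≤z′ ∷ zs

-- branches cons f lo hi = concat [ map (cons x) (f x) | lo ≤ x < hi ]
branches : {B : Set} → (ℕ → B → B) → (ℕ → List B) → ℕ → ℕ → List B
branches cons f zero    zero    = []
branches cons f zero    (suc h) = map (cons 0) (f 0) ++ branches (λ x → cons (suc x)) (λ x → f (suc x)) 0 h
branches cons f (suc l) zero    = []
branches cons f (suc l) (suc h) = branches (λ x → cons (suc x)) (λ x → f (suc x)) l h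

module _ {B : Set} where

  ∈-branches⁻ : ∀ {cons : ℕ → B → B} {f} lo hi {z} → z ∈ branches cons f lo hi →
    ∃₂ λ x w → lo ≤ x × x < hi × w ∈ f x × z ≡ cons x w
  ∈-branches⁻ {cons} {f} zero (suc h) z∈ with ∈-++⁻ (map (cons 0) (f 0)) z∈
  ... | inj₁ z∈₀ = let w , w∈ , z≡ = ∈-map⁻ (cons 0) z∈₀ in 0 , w , z≤n , s≤s z≤n , w∈ , z≡
  ... | inj₂ z∈₊ = let x , w , _ , x<h , w∈ , z≡ = ∈-branches⁻ zero h z∈₊ in
                   suc x , w , z≤n , s≤s x<h , w∈ , z≡
  ∈-branches⁻ (suc l) (suc h) z∈ = let x , w , l≤x , x<h , w∈ , z≡ = ∈-branches⁻ l h z∈ in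
                                   suc x , w , s≤s l≤x , s≤s x<h , w∈ , z≡

  ∈-branches⁺ : ∀ {cons : ℕ → B → B} {f lo hi x w} → lo ≤ x → x < hi → w ∈ f x →
    cons x w ∈ branches cons f lo hi
  ∈-branches⁺ {cons} {lo = zero} {suc h} {zero}  _         _         w∈ = ∈-++⁺ˡ (∈-map⁺ (cons 0) w∈)
  ∈-branches⁺ {cons} {f} {zero} {suc h} {suc x} _ (s≤s x<h) w∈ =
    ∈-++⁺ʳ (map (cons 0) (f 0)) (∈-branches⁺ z≤n x<h w∈)
  ∈-branches⁺ {lo = suc l} {suc h} (s≤s l≤x) (s≤s x<h) w∈ = ∈-branches⁺ l≤x x<h w∈

  branches-unique : ∀ {cons : ℕ → B → B} {f} lo hi →
    (∀ {x y w w′} → cons x w ≡ cons y w′ → x ≡ y × w ≡ w′) → (∀ x → Unique (f x)) →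
    Unique (branches cons f lo hi)
  branches-unique zero    zero    _   _   = []
  branches-unique {cons} {f} zero (suc h) inj uniq =
    Unique.++⁺ (Unique.map⁺ (λ eq → proj₂ (inj eq)) (uniq 0))
               (branches-unique zero h (λ eq → map₁ suc-injective (inj eq)) (λ x → uniq (suc x)))
               disjoint
    where
    disjoint : ∀ {z} → ¬ (z ∈ map (cons 0) (f 0) × z ∈ branches (λ x → cons (suc x)) (λ x → f (suc x)) 0 h)
    disjoint (z∈₀ , z∈₊) with ∈-map⁻ (cons 0) z∈₀ | ∈-branches⁻ zero h z∈₊
    ... | _ , _ , refl | _ , _ , _ , _ , _ , eq = 0≢1+n (proj₁ (inj eq))
  branches-unique (suc l) zero    _   _   = []
  branches-unique (suc l) (suc h) inj uniq =
    branches-unique l h (λ eq → map₁ suc-injective (inj eq)) (λ x → uniq (suc x))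

  length-branches : ∀ {cons : ℕ → B → B} {f} lo hi (g : ℕ → ℕ) →
    (∀ x → lo ≤ x → x < hi → length (f x) ≡ g (hi ∸ x)) → length (branches cons f lo hi) ≡ ∑ (hi ∸ lo) g
  length-branches zero    zero    g _   = refl
  length-branches {cons} {f} zero (suc h) g len = begin
    length (map (cons 0) (f 0) ++ rest)      ≡⟨ length-++ (map (cons 0) (f 0)) ⟩
    length (map (cons 0) (f 0)) + length rest ≡⟨ cong₂ _+_ (trans (length-map (cons 0) (f 0)) (len 0 z≤n (s≤s z≤n)))
                                                            (length-branches zero h g λ x _ x<h → len (suc x) z≤n (s≤s x<h)) ⟩
    g (suc h) + ∑ h g                        ∎
    where
    open ≡-Reasoning
    rest : List B
    rest = branches (λ x → cons (suc x)) (λ x → f (suc x)) 0 h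
  length-branches (suc l) zero    g _   = refl
  length-branches (suc l) (suc h) g len =
    length-branches l h g λ x l≤x x<h → len (suc x) (s≤s l≤x) (s≤s x<h)

Pair : Set
Pair = List ℕ × List ℕ

consA : ℕ → Pair → Pair
consA x (as , bs) = x ∷ as , bs

consB : ℕ → Pair → Pair
consB y (as , bs) = as , y ∷ bs

consA-injective : ∀ {x y w w′} → consA x w ≡ consA y w′ → x ≡ y × w ≡ w′
consA-injective {w = _ , _} {w′ = _ , _} refl = refl , refl

consB-injective : ∀ {x y w w′} → consB x w ≡ consB y w′ → x ≡ y × w ≡ w′
consB-injective {w = _ , _} {w′ = _ , _} refl = refl , refl

module Enumeration (u v : ℕ → ℕ → ℕ)
                   (u-monoʳ : ∀ i j → u i j ≤ u i (suc j))
                   (v-monoˡ : ∀ i j → v i j ≤ v (suc i) j) where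

  -- α and β are the last entries chosen so far; the path resumes at (i, j).
  IPF2From : (i j m n α β : ℕ) → Pair → Set
  IPF2From i j m n α β (as , bs) =
    length as ≡ m × length bs ≡ n × Linked _≤_ (α ∷ as) × Linked _≤_ (β ∷ bs) ×
    ∃ λ P → Bounded u v i j P as bs

  -- Flipping NE to EN keeps the path bounding since u grows in j and v in i.
  east-first : ∀ {i j P x as bs} → x < u i j → Bounded u v i j P (x ∷ as) bs →
    ∃ λ P′ → Bounded u v (suc i) j P′ as bs
  east-first {P = []} _ ()
  east-first {P = E ∷ P} _ (_ , B) = P , B
  east-first {P = N ∷ P} {bs = []} _ ()
  east-first {i} {j} {N ∷ P} {bs = _ ∷ _} x<u (y<v , B) =
    let P′ , B′ = east-first (<-≤-trans x<u (u-monoʳ i j)) B in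
    N ∷ P′ , <-≤-trans y<v (v-monoˡ i j) , B′

  north-first : ∀ {i j P as y bs} → Linked _≤_ (u i j ∷ as) → Bounded u v i j P as (y ∷ bs) →
    y < v i j × ∃ λ P′ → Bounded u v i (suc j) P′ as bs
  north-first {P = N ∷ P} _ (y<v , B) = y<v , P , B
  north-first {P = E ∷ P} {as = _ ∷ _} u≤x (x<u , _) = ⊥-elim (<⇒≱ x<u (head u≤x))
  north-first {P = []} {as = []}    _ ()
  north-first {P = []} {as = _ ∷ _} _ ()
  north-first {P = E ∷ P} {as = []} _ ()

  east-only : ∀ {i j P x as} → Bounded u v i j P (x ∷ as) [] → x < u i j
  east-only {P = []} ()
  east-only {P = E ∷ _} (x<u , _) = x<u
  east-only {P = N ∷ _} ()

  mutual
    enumerate : (i j m n α β : ℕ) → List Pair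
    enumerate i j zero    zero    α β = [ [] , [] ]
    enumerate i j (suc m) zero    α β = eastFirst i j m zero α β
    enumerate i j zero    (suc n) α β = northFirst i j zero n α β
    enumerate i j (suc m) (suc n) α β = eastFirst i j m (suc n) α β ++ northFirst i j (suc m) n α β

    eastFirst : (i j m n α β : ℕ) → List Pair
    eastFirst i j m n α β = branches consA (λ x → enumerate (suc i) j m n x β) α (u i j)

    northFirst : (i j m n α β : ℕ) → List Pair
    northFirst i j m n α β = branches consB (λ y → enumerate i (suc j) m n (α ⊔ u i j) y) β (v i j)

  mutual
    enumerate-sound : ∀ i j m n α β {z} → z ∈ enumerate i j m n α β → IPF2From i j m n α β z
    enumerate-sound i j zero    zero    α β (here refl) = refl , refl , [-] , [-] , [] , tt
    enumerate-sound i j (suc m) zero    α β z∈ = eastFirst-sound i j m zero α β z∈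
    enumerate-sound i j zero    (suc n) α β z∈ = northFirst-sound i j zero n α β z∈
    enumerate-sound i j (suc m) (suc n) α β z∈ with ∈-++⁻ (eastFirst i j m (suc n) α β) z∈
    ... | inj₁ z∈ₑ = eastFirst-sound i j m (suc n) α β z∈ₑ
    ... | inj₂ z∈ₙ = northFirst-sound i j (suc m) n α β z∈ₙ

    eastFirst-sound : ∀ i j m n α β {z} → z ∈ eastFirst i j m n α β → IPF2From i j (suc m) n α β z
    eastFirst-sound i j m n α β z∈ with ∈-branches⁻ α (u i j) z∈
    ... | x , (as , bs) , α≤x , x<u , w∈ , refl with enumerate-sound (suc i) j m n x β w∈
    ... | la , lb , Las , Lbs , P , B = cong suc la , lb , α≤x ∷ Las , Lbs , E ∷ P , x<u , B

    northFirst-sound : ∀ i j m n α β {z} → z ∈ northFirst i j m n α β → IPF2From i j m (suc n) α β z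
    northFirst-sound i j m n α β z∈ with ∈-branches⁻ β (v i j) z∈
    ... | y , (as , bs) , β≤y , y<v , w∈ , refl with enumerate-sound i (suc j) m n (α ⊔ u i j) y w∈
    ... | la , lb , Las , Lbs , P , B =
      la , cong suc lb , Linked-lowerHead (m≤m⊔n α (u i j)) Las , β≤y ∷ Lbs , N ∷ P , y<v , B

  eastFirst-northFirst-disjoint : ∀ i j m n α β {z} →
    ¬ (z ∈ eastFirst i j m (suc n) α β × z ∈ northFirst i j (suc m) n α β)
  eastFirst-northFirst-disjoint i j m n α β (z∈ₑ , z∈ₙ)
    with ∈-branches⁻ α (u i j) z∈ₑ | ∈-branches⁻ β (v i j) z∈ₙ
  ... | x , (_ , _) , _ , x<u , _ , refl | y , (_ , _) , _ , _ , w∈ , refl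
    with enumerate-sound i (suc j) (suc m) n (α ⊔ u i j) y w∈
  ... | _ , _ , α⊔u≤x ∷ _ , _ = <⇒≱ x<u (≤-trans (m≤n⊔m α (u i j)) α⊔u≤x)

  mutual
    enumerate-unique : ∀ i j m n α β → Unique (enumerate i j m n α β)
    enumerate-unique i j zero    zero    α β = [] ∷ []
    enumerate-unique i j (suc m) zero    α β = eastFirst-unique i j m zero α β
    enumerate-unique i j zero    (suc n) α β = northFirst-unique i j zero n α β
    enumerate-unique i j (suc m) (suc n) α β =
      Unique.++⁺ (eastFirst-unique i j m (suc n) α β) (northFirst-unique i j (suc m) n α β)
                 (eastFirst-northFirst-disjoint i j m n α β)

    eastFirst-unique : ∀ i j m n α β → Unique (eastFirst i j m n α β)
    eastFirst-unique i j m n α β =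
      branches-unique α (u i j) consA-injective λ x → enumerate-unique (suc i) j m n x β

    northFirst-unique : ∀ i j m n α β → Unique (northFirst i j m n α β)
    northFirst-unique i j m n α β =
      branches-unique β (v i j) consB-injective λ y → enumerate-unique i (suc j) m n (α ⊔ u i j) y

  eastFirst⊆enumerate : ∀ i j m n α β {z} → z ∈ eastFirst i j m n α β → z ∈ enumerate i j (suc m) n α β
  eastFirst⊆enumerate i j m zero    α β z∈ = z∈
  eastFirst⊆enumerate i j m (suc n) α β z∈ = ∈-++⁺ˡ z∈

  northFirst⊆enumerate : ∀ i j m n α β {z} → z ∈ northFirst i j m n α β → z ∈ enumerate i j m (suc n) α β
  northFirst⊆enumerate i j zero    n α β z∈ = z∈
  northFirst⊆enumerate i j (suc m) n α β z∈ = ∈-++⁺ʳ (eastFirst i j m (suc n) α β) z∈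

  enumerate-complete : ∀ {i j m n α β} as bs → IPF2From i j m n α β (as , bs) →
    (as , bs) ∈ enumerate i j m n α β
  enumerate-complete [] [] (refl , refl , _) = here refl
  enumerate-complete {i} {j} {n = n} {α} {β} (x ∷ as) bs (refl , lb , Las , Lbs , _ , B) with x <? u i j
  ... | yes x<u = eastFirst⊆enumerate i j (length as) n α β
    (∈-branches⁺ (head Las) x<u (enumerate-complete as bs (refl , lb , tail Las , Lbs , east-first x<u B)))
  enumerate-complete (x ∷ as) [] (refl , refl , _ , _ , _ , B) | no x≮u = ⊥-elim (x≮u (east-only B))
  enumerate-complete {i} {j} {α = α} {β} (x ∷ as) (y ∷ bs) (refl , refl , Las , Lbs , _ , B) | no x≮u =
    let u≤x = ≮⇒≥ x≮u
        y<v , P′ , B′ = north-first (u≤x ∷ tail Las) B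
    in northFirst⊆enumerate i j (suc (length as)) (length bs) α β
      (∈-branches⁺ (head Lbs) y<v
        (enumerate-complete (x ∷ as) bs (refl , refl , ⊔-lub (head Las) u≤x ∷ tail Las , tail Lbs , P′ , B′)))
  enumerate-complete {i} {j} {α = α} {β} [] (y ∷ bs) (refl , refl , _ , Lbs , _ , B) =
    let y<v , P′ , B′ = north-first [-] B in
    northFirst⊆enumerate i j 0 (length bs) α β
      (∈-branches⁺ (head Lbs) y<v (enumerate-complete [] bs (refl , refl , [-] , tail Lbs , P′ , B′)))

  IPF2-hasCard : ∀ m n → HasCard (IPF2 u v m n) (length (enumerate 0 0 m n 0 0))
  IPF2-hasCard m n = enumerate 0 0 m n 0 0 , enumerate-unique 0 0 m n 0 0 , ∈⇔IPF2 , refl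
    where
    ∈⇔IPF2 : ∀ z → z ∈ enumerate 0 0 m n 0 0 ⇔ IPF2 u v m n z
    ∈⇔IPF2 (as , bs) = mk⇔
      (λ z∈ → let la , lb , Las , Lbs , PB = enumerate-sound 0 0 m n 0 0 z∈ in la , lb , tail Las , tail Lbs , PB)
      (λ (la , lb , Las , Lbs , PB) → enumerate-complete as bs (la , lb , Linked-0∷ Las , Linked-0∷ Lbs , PB))

affine : (x y z i j : ℕ) → ℕ
affine x y z i j = x * i + y * j + z

affine-sucˡ : ∀ x y z i j → affine x y z (suc i) j ≡ affine x y z i j + x
affine-sucˡ = expand
  where
  expand : ∀ x y z i j → x * suc i + y * j + z ≡ x * i + y * j + z + x
  expand = solve-∀

affine-sucʳ : ∀ x y z i j → affine x y z i (suc j) ≡ affine x y z i j + y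
affine-sucʳ = expand
  where
  expand : ∀ x y z i j → x * i + y * suc j + z ≡ x * i + y * j + z + y
  expand = solve-∀

affine-origin : ∀ x y z → affine x y z 0 0 ≡ z
affine-origin = expand
  where
  expand : ∀ x y z → x * 0 + y * 0 + z ≡ z
  expand = solve-∀

affine-monoˡ : ∀ x y z i j → affine x y z i j ≤ affine x y z (suc i) j
affine-monoˡ x y z i j = subst (affine x y z i j ≤_) (sym (affine-sucˡ x y z i j)) (m≤m+n _ x)

affine-monoʳ : ∀ x y z i j → affine x y z i j ≤ affine x y z i (suc j)
affine-monoʳ x y z i j = subst (affine x y z i j ≤_) (sym (affine-sucʳ x y z i j)) (m≤m+n _ y)

gap-sucˡ : ∀ x y z i j {w} → w ≤ affine x y z i j → affine x y z (suc i) j ∸ w ≡ (affine x y z i j ∸ w) + x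
gap-sucˡ x y z i j {w} w≤ = trans (cong (_∸ w) (affine-sucˡ x y z i j)) (+-∸-comm x w≤)

gap-sucʳ : ∀ x y z i j {w} → w ≤ affine x y z i j → affine x y z i (suc j) ∸ w ≡ (affine x y z i j ∸ w) + y
gap-sucʳ x y z i j {w} w≤ = trans (cong (_∸ w) (affine-sucʳ x y z i j)) (+-∸-comm y w≤)

module AffineBounds (a b c d s t : ℕ) where

  u v : ℕ → ℕ → ℕ
  u = affine a b s
  v = affine c d t

  open Counting a b c d
  open Enumeration u v (affine-monoʳ a b s) (affine-monoˡ c d t)

  mutual
    length-enumerate : ∀ i j m n α β → α ≤ u i j → β ≤ v i j →
      length (enumerate i j m n α β) ≡ count m n (u i j ∸ α) (v i j ∸ β)
    length-enumerate i j zero    zero    α β _   _   = refl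
    length-enumerate i j (suc m) zero    α β _   β≤v = length-eastFirst i j m zero α β β≤v
    length-enumerate i j zero    (suc n) α β α≤u _   = length-northFirst i j zero n α β α≤u
    length-enumerate i j (suc m) (suc n) α β α≤u β≤v =
      trans (length-++ (eastFirst i j m (suc n) α β))
            (cong₂ _+_ (length-eastFirst i j m (suc n) α β β≤v) (length-northFirst i j (suc m) n α β α≤u))

    length-eastFirst : ∀ i j m n α β → β ≤ v i j →
      length (eastFirst i j m n α β) ≡ ∑ (u i j ∸ α) λ e → count m n (e + a) ((v i j ∸ β) + c)
    length-eastFirst i j m n α β β≤v = length-branches α (u i j) _ λ x _ x<u →
      trans (length-enumerate (suc i) j m n x β (≤-trans (<⇒≤ x<u) (affine-monoˡ a b s i j))
                                              (≤-trans β≤v (affine-monoˡ c d t i j)))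
            (cong₂ (count m n) (gap-sucˡ a b s i j (<⇒≤ x<u)) (gap-sucˡ c d t i j β≤v))

    length-northFirst : ∀ i j m n α β → α ≤ u i j →
      length (northFirst i j m n α β) ≡ ∑ (v i j ∸ β) λ e → count m n b (e + d)
    length-northFirst i j m n α β α≤u = length-branches β (v i j) _ λ y _ y<v →
      trans (length-enumerate i (suc j) m n (α ⊔ u i j) y
               (≤-trans (≤-reflexive (m≤n⇒m⊔n≡n α≤u)) (affine-monoʳ a b s i j))
               (≤-trans (<⇒≤ y<v) (affine-monoʳ c d t i j)))
            (cong₂ (count m n) gapᵤ (gap-sucʳ c d t i j (<⇒≤ y<v)))
      where
      gapᵤ : u i (suc j) ∸ (α ⊔ u i j) ≡ b
      gapᵤ = trans (cong₂ _∸_ (affine-sucʳ a b s i j) (m≤n⇒m⊔n≡n α≤u)) (m+n∸m≡n (u i j) b)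

  IPF2-affine-hasCard : ∀ m n → HasCard (IPF2 u v m n) (count m n s t)
  IPF2-affine-hasCard m n = subst (HasCard (IPF2 u v m n)) length≡count (IPF2-hasCard m n)
    where
    length≡count : length (enumerate 0 0 m n 0 0) ≡ count m n s t
    length≡count = trans (length-enumerate 0 0 m n 0 0 z≤n z≤n)
                         (cong₂ (count m n) (affine-origin a b s) (affine-origin c d t))

proposition13 : (m n a b c d s t : ℕ) → 1 ≤ m → 1 ≤ n →
    Σ ℕ λ K →
      HasCard (IPF2 (λ i j → a * i + b * j + s) (λ i j → c * i + d * j + t) m n) K ×
      (m !) * (n !) * K ≡
        (s * t + b * n * t + s * c * m)
        * rising (s + a * m + b * n + 1) (m ∸ 1)
        * rising (t + c * m + d * n + 1) (n ∸ 1)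
proposition13 (suc m) (suc n) a b c d s t _ _ =
  count (suc m) (suc n) s t , IPF2-affine-hasCard (suc m) (suc n) , count-closedForm (suc m) (suc n) s t
  where
  open Counting a b c d
  open AffineBounds a b c d s t
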